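{- Let $(X,\mathcal O_X)$ be an Alexandroff space. Any two distinct points of a separated subset $U\subseteq X$ (i.e. $U=U^\star$) are topologically distinguishable. Moreover: (1) $U^\star=(U^\star)^\star$ for every $U\subseteq X$; (2) if $U_1\subseteq U_2$ and $U_2=U_2^\star$ then $U_1=U_1^\star$; (3) for every $U\subseteq X$, $({\uparrow}U)^\star\subseteq U^\star$, and if $X$ is a $T_0$ space then also $U^\star\subseteq({\uparrow}U)^\star$, where ${\uparrow}U=\{x'\mid \exists x\in U,\ x\preceq x'\}$ for the specialisation order $x\preceq x'$ iff $\overline{\{x\}}\subseteq\overline{\{x'\}}$.
   Context: An Alexandroff space is a topological space whose open sets are closed under arbitrary intersections. $\overline{\{x\}}$ denotes the closure of the point $x$. The separation closure of $U\subseteq X$ is $U^\star=\{x\in U\mid \overline{\{x\}}\cap U=\{x\}\}$; $U$ is separated if $U=U^\star$. Two points are topologically distinguishable if some open set contains exactly one of them; a $T_0$ space is one in which any two distinct points are topologically distinguishable. -}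

module Defs where

open import Level using (0ℓ; Level) renaming (suc to lsuc)
open import Data.Product using (Σ; _×_; _,_)
open import Data.Sum using (_⊎_)
open import Data.Bool using (Bool)
open import Relation.Nullary using (¬_)
open import Relation.Unary using (Pred; _⊆_; _≐_; _∈_)
open import Relation.Binary.PropositionalEquality using (_≡_; _≢_)

record AlexandroffSpace : Set₁ where
  field
    Carrier   : Set
    Open      : Pred Carrier 0ℓ → Set
    Open-resp : ∀ {O O′ : Pred Carrier 0ℓ} → O ≐ O′ → Open O → Open O′
    Open-⋃    : ∀ {I : Set} (F : I → Pred Carrier 0ℓ) →
                (∀ i → Open (F i)) → Open (λ x → Σ I (λ i → F i x))
    Open-⋂    : ∀ {I : Set} (F : I → Pred Carrier 0ℓ) →
                (∀ i → Open (F i)) → Open (λ x → ∀ i → F i x)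

module Notions (S : AlexandroffSpace) where
  open AlexandroffSpace S public

  -- Arbitrary subsets of the space (Set₁-valued, since point closures
  -- quantify over all open sets).
  Subset : Set₂
  Subset = Pred Carrier (lsuc 0ℓ)

  cl : Carrier → Subset
  cl x y = ∀ (O : Pred Carrier 0ℓ) → Open O → O y → O x

  _⋆ : Subset → Subset
  (U ⋆) x = U x × (∀ y → y ∈ cl x → y ∈ U → y ≡ x)

  Separated : Subset → Set₁
  Separated U = U ≐ (U ⋆)

  Distinguishable : Carrier → Carrier → Set₁
  Distinguishable x y = Σ (Pred Carrier 0ℓ) λ O → Open O ×
    ((O x × ¬ O y) ⊎ (O y × ¬ O x))

  T0 : Set₁
  T0 = ∀ x y → x ≢ y → Distinguishable x y

  _≼_ : Carrier → Carrier → Set₁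
  x ≼ x′ = cl x ⊆ cl x′

  ↑ : Subset → Subset
  ↑ U x′ = Σ Carrier λ x → U x × (x ≼ x′)

module Submission where

-- Everything rests on a few facts about point closures:
-- reflexivity and transitivity of "y ∈ cl x", the fact that x ≼ x′
-- places x in the closure of x′, and (classically) that two
-- indistinguishable points lie in each other's closure, while in a
-- T0 space two points in each other's closure coincide.
-- On the side of the separation closure, the key observation is that
-- separation is inherited by subsets: if V ⊆ U then every point of V
-- that is separated in U is separated in V.  Items (2), (3) and the
-- first half of (4) are instances of this inheritance (for U⋆ ⊆ U,
-- U₁ ⊆ U₂ and U ⊆ ↑U respectively); item (1) and the T0 half of (4)
-- combine it with the closure facts above.

open import Defs
open import Level using (Level)
open import Data.Product using (_×_; _,_; proj₁; proj₂)
open import Data.Sum using (inj₁; inj₂)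
open import Data.Empty using (⊥-elim)
open import Relation.Nullary using (¬_; yes; no)
open import Relation.Unary using (_⊆_; _≐_; _∈_; _∩_)
open import Relation.Binary.PropositionalEquality using (_≢_; _≡_; subst; sym)
open import Axiom.ExcludedMiddle using (ExcludedMiddle)

module ClosureProperties (S : AlexandroffSpace) where
  open Notions S

  cl-refl : ∀ x → x ∈ cl x
  cl-refl x O _ Ox = Ox

  cl-trans : ∀ {x y z} → y ∈ cl x → z ∈ cl y → z ∈ cl x
  cl-trans y∈clx z∈cly O isOpen Oz = y∈clx O isOpen (z∈cly O isOpen Oz)

  ≼⇒∈cl : ∀ {x x′} → x ≼ x′ → x ∈ cl x′
  ≼⇒∈cl {x} x≼x′ = x≼x′ (cl-refl x)

  ⊆↑ : ∀ (U : Subset) → U ⊆ ↑ U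
  ⊆↑ U {x} Ux = x , Ux , λ y∈clx → y∈clx

  indistinguishable⇒∈cl : (∀ {ℓ : Level} → ExcludedMiddle ℓ) →
    ∀ {x y} → ¬ Distinguishable x y → y ∈ cl x
  indistinguishable⇒∈cl em {x} {y} ¬dist O isOpen Oy with em {P = O x}
  ... | yes Ox = Ox
  ... | no ¬Ox = ⊥-elim (¬dist (O , isOpen , inj₂ (Oy , ¬Ox)))

  T0-antisym : (∀ {ℓ : Level} → ExcludedMiddle ℓ) → T0 →
    ∀ {x y} → y ∈ cl x → x ∈ cl y → y ≡ x
  T0-antisym em t0 {x} {y} y∈clx x∈cly with em {P = y ≡ x}
  ... | yes y≡x = y≡x
  ... | no y≢x with t0 y x y≢x
  ...   | O , isOpen , inj₁ (Oy , ¬Ox) = ⊥-elim (¬Ox (y∈clx O isOpen Oy))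
  ...   | O , isOpen , inj₂ (Ox , ¬Oy) = ⊥-elim (¬Oy (x∈cly O isOpen Ox))

  ⋆-deflationary : ∀ (U : Subset) → U ⋆ ⊆ U
  ⋆-deflationary U = proj₁

  separated-if-⊆⋆ : ∀ (U : Subset) → U ⊆ U ⋆ → Separated U
  separated-if-⊆⋆ U U⊆U⋆ = U⊆U⋆ , ⋆-deflationary U

  ⋆-inherit : ∀ {V U : Subset} → V ⊆ U → V ∩ (U ⋆) ⊆ V ⋆
  ⋆-inherit V⊆U (Vx , _ , isolated) = Vx , λ y y∈clx Vy → isolated y y∈clx (V⊆U Vy)

  separated⇒distinguishable : (∀ {ℓ : Level} → ExcludedMiddle ℓ) →
    ∀ (U : Subset) → Separated U → ∀ x y → U x → U y → x ≢ y → Distinguishable x y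
  separated⇒distinguishable em U (U⊆U⋆ , _) x y Ux Uy x≢y with em {P = Distinguishable x y}
  ... | yes dist = dist
  ... | no ¬dist =
    ⊥-elim (x≢y (sym (proj₂ (U⊆U⋆ Ux) y (indistinguishable⇒∈cl em ¬dist) Uy)))

  ⋆-idempotent : ∀ (U : Subset) → (U ⋆) ≐ ((U ⋆) ⋆)
  ⋆-idempotent U = (λ U⋆x → ⋆-inherit (⋆-deflationary U) (U⋆x , U⋆x)) , ⋆-deflationary (U ⋆)

  separated-⊆ : ∀ (U₁ U₂ : Subset) → U₁ ⊆ U₂ → Separated U₂ → Separated U₁
  separated-⊆ U₁ U₂ U₁⊆U₂ (U₂⊆U₂⋆ , _) =
    separated-if-⊆⋆ U₁ λ U₁x → ⋆-inherit U₁⊆U₂ (U₁x , U₂⊆U₂⋆ (U₁⊆U₂ U₁x))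

  -- (3a) A separated point of ↑U already lies in U (it is the only point
  -- of its closure in ↑U, and any witness below it is such a point), so
  -- it is separated in U.
  ↑⋆⊆⋆ : ∀ (U : Subset) → (↑ U) ⋆ ⊆ U ⋆
  ↑⋆⊆⋆ U {x} ↑U⋆x@((x₀ , Ux₀ , x₀≼x) , isolated) =
    ⋆-inherit (⊆↑ U) (subst U x₀≡x Ux₀ , ↑U⋆x)
    where
    x₀≡x : x₀ ≡ x
    x₀≡x = isolated x₀ (≼⇒∈cl x₀≼x) (⊆↑ U Ux₀)

  -- (3b) In a T0 space, a point x separated in U stays separated in ↑U:
  -- if y ∈ cl x lies above z ∈ U, then z ∈ cl x forces z = x, so x and y
  -- lie in each other's closure and coincide.
  ⋆⊆↑⋆ : (∀ {ℓ : Level} → ExcludedMiddle ℓ) → T0 → ∀ (U : Subset) → U ⋆ ⊆ (↑ U) ⋆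
  ⋆⊆↑⋆ em t0 U {x} (Ux , isolated) = ⊆↑ U Ux , isolated↑
    where
    isolated↑ : ∀ y → y ∈ cl x → y ∈ ↑ U → y ≡ x
    isolated↑ y y∈clx (z , Uz , z≼y) = T0-antisym em t0 y∈clx x∈cly
      where
      z≡x : z ≡ x
      z≡x = isolated z (cl-trans y∈clx (≼⇒∈cl z≼y)) Uz
      x∈cly : x ∈ cl y
      x∈cly = subst (λ w → w ∈ cl y) z≡x (≼⇒∈cl z≼y)

proposition46 : (em : ∀ {ℓ : Level} → ExcludedMiddle ℓ) → (S : AlexandroffSpace) →
    let open Notions S in
    (∀ (U : Subset) → Separated U → ∀ x y → U x → U y → x ≢ y → Distinguishable x y)
    × (∀ (U : Subset) → (U ⋆) ≐ ((U ⋆) ⋆))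
    × (∀ (U₁ U₂ : Subset) → U₁ ⊆ U₂ → Separated U₂ → Separated U₁)
    × (∀ (U : Subset) → ((↑ U) ⋆) ⊆ (U ⋆))
    × (T0 → ∀ (U : Subset) → (U ⋆) ⊆ ((↑ U) ⋆))
proposition46 em S =
  separated⇒distinguishable em , ⋆-idempotent , separated-⊆ , ↑⋆⊆⋆ , ⋆⊆↑⋆ em
  where open ClosureProperties S
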